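{- Let $S=\tau_{s_1}\tau_{s_2}\tau_{s_3}\cdots$ be any $\tau$-mutation sequence on the dP3 quiver $Q$, and let $\mathcal{C}_n(Q)$ be the ordered cluster (entry $k$ being the cluster variable at vertex $k$) obtained after applying the first $n$ terms of $S$. Then there exist exponents $a_1,b_1,c_1,a_2,b_2,c_2,a_3,b_3,c_3$ (depending on $n$) such that $$\mathcal{C}_n(Q)=\{x_{f_0(n)}A^{a_1}B^{b_1}C^{c_1},\ x_{f_1(n)}A^{a_1}B^{b_1}C^{c_1},\ x_{f_2(n)}A^{a_2}B^{b_2}C^{c_2},\ x_{f_3(n)}A^{a_2}B^{b_2}C^{c_2},\ x_{f_4(n)}A^{a_3}B^{b_3}C^{c_3},\ x_{f_5(n)}A^{a_3}B^{b_3}C^{c_3}\},$$ where $A=\frac{x_2x_4+x_3x_5}{x_0x_1}$, $B=\frac{x_1x_4+x_0x_5}{x_2x_3}$, $C=\frac{x_0x_2+x_1x_3}{x_4x_5}$.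
   Context: The dP3 quiver $Q$ has vertices $0,\dots,5$ and arrows $3\to1,\ 1\to4,\ 4\to2,\ 2\to0,\ 0\to5,\ 5\to3,\ 3\to4,\ 4\to0,\ 0\to3,\ 1\to2,\ 2\to5,\ 5\to1$, with initial cluster variable $x_i$ at vertex $i$. Mutations $\mu_i$ are the usual Fomin–Zelevinsky quiver/seed mutations (exchange relation $x_i'x_i=\prod_{i\to j}x_j+\prod_{j\to i}x_j$). Set $\tau_1=\mu_0\circ\mu_1$, $\tau_2=\mu_2\circ\mu_3$, $\tau_3=\mu_4\circ\mu_5$; a $\tau$-mutation sequence $\tau_{s_1}\tau_{s_2}\cdots$ ($s_m\in\{1,2,3\}$) applies $\tau_{s_1}$ first, then $\tau_{s_2}$, etc., starting from $(Q,(x_0,\dots,x_5))$. Let $\eta(n,i)$ be the number of times vertex $i$ has been mutated in the first $n$ terms of $S$ ($2n$ mutations in total). For $i\in\{0,2,4\}$, $f_i(n)=i$ if $\eta(n,i)$ is even and $f_i(n)=i+1$ otherwise; for $i\in\{1,3,5\}$, $f_i(n)=i$ if $\eta(n,i)$ is even and $f_i(n)=i-1$ otherwise. -}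

module Defs where

open import Level using (Level; _⊔_)
open import Data.Nat as ℕ using (ℕ; zero; suc; _%_)
open import Data.Integer as ℤ using (ℤ; +_; -[1+_]; 0ℤ)
open import Data.Fin using (Fin; zero; suc; #_; _≟_; toℕ)
open import Data.Bool using (Bool; true; false; if_then_else_; _∨_)
open import Data.Product using (_×_; _,_; proj₁; proj₂)
open import Data.List using (List; []; _∷_)
open import Relation.Nullary using (does)
open import Relation.Binary.Core using (Rel)
open import Algebra.Core using (Op₁; Op₂)
open import Algebra.Definitions using (_DistributesOver_)
open import Algebra.Structures using (IsCommutativeSemigroup; IsAbelianGroup)

-- Subtraction-free rational identities hold in the universal semifield
-- Q_sf(x_0..x_5) (and hence in Q(x_0..x_5)) iff they hold in every
-- semifield for every choice of values of the x_i.

record Semifield c ℓ : Set (Level.suc (c ⊔ ℓ)) where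
  infixl 7 _*_
  infixl 6 _+_
  infix  4 _≈_
  field
    Carrier : Set c
    _≈_     : Rel Carrier ℓ
    _+_     : Op₂ Carrier
    _*_     : Op₂ Carrier
    1#      : Carrier
    _⁻¹     : Op₁ Carrier
    +-isCommutativeSemigroup : IsCommutativeSemigroup _≈_ _+_
    *-isAbelianGroup         : IsAbelianGroup _≈_ _*_ 1# _⁻¹
    distrib                  : _DistributesOver_ _≈_ _*_ _+_

module _ {c ℓ} (F : Semifield c ℓ) where
  open Semifield F

  _^ℕ_ : Carrier → ℕ → Carrier
  x ^ℕ zero  = 1#
  x ^ℕ suc n = x * (x ^ℕ n)

  _^ℤ_ : Carrier → ℤ → Carrier
  x ^ℤ (+ n)     = x ^ℕ n
  x ^ℤ -[1+ n ]  = (x ^ℕ suc n) ⁻¹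

  ∏ : ∀ m → (Fin m → Carrier) → Carrier
  ∏ zero    g = 1#
  ∏ (suc m) g = g zero * ∏ m (λ j → g (suc j))

-- Quivers (without loops / 2-cycles) on 6 vertices, encoded by their
-- skew-symmetric exchange matrix: b i j = #(i → j) − #(j → i).

ExMatrix : Set
ExMatrix = Fin 6 → Fin 6 → ℤ

-- arrows of the dP3 quiver, as pairs (source , target)
dP3-arrows : List (ℕ × ℕ)
dP3-arrows =
  (3 , 1) ∷ (1 , 4) ∷ (4 , 2) ∷ (2 , 0) ∷ (0 , 5) ∷ (5 , 3) ∷
  (3 , 4) ∷ (4 , 0) ∷ (0 , 3) ∷ (1 , 2) ∷ (2 , 5) ∷ (5 , 1) ∷ []

countArrows : List (ℕ × ℕ) → ℕ → ℕ → ℕ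
countArrows []             i j = 0
countArrows ((a , b) ∷ as) i j =
  (if does (a ℕ.≟ i) Data.Bool.∧ does (b ℕ.≟ j) then 1 else 0)
  ℕ.+ countArrows as i j

dP3 : ExMatrix
dP3 i j = (+ countArrows dP3-arrows (toℕ i) (toℕ j))
          ℤ.- (+ countArrows dP3-arrows (toℕ j) (toℕ i))

pos : ℤ → ℕ
pos (+ n)    = n
pos -[1+ n ] = 0

mutB : Fin 6 → ExMatrix → ExMatrix
mutB k b i j =
  if does (i ≟ k) ∨ does (j ≟ k)
  then ℤ.- b i j
  else b i j ℤ.+ (+ (pos (b i k) ℕ.* pos (b k j)))
             ℤ.- (+ (pos (ℤ.- b i k) ℕ.* pos (ℤ.- b k j)))

module _ {c ℓ} (F : Semifield c ℓ) where
  open Semifield F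

  Seed : Set c
  Seed = ExMatrix × (Fin 6 → Carrier)

  μ : Fin 6 → Seed → Seed
  μ k (b , x) = mutB k b , x′
    where
      x′ : Fin 6 → Carrier
      x′ j = if does (j ≟ k)
             then (∏ F 6 (λ i → _^ℕ_ F (x i) (pos (b k i)))
                   + ∏ F 6 (λ i → _^ℕ_ F (x i) (pos (ℤ.- b k i)))) * (x k ⁻¹)
             else x j

  -- τ_1 = μ_0 ∘ μ_1, τ_2 = μ_2 ∘ μ_3, τ_3 = μ_4 ∘ μ_5
  -- (the index s : Fin 3 is 0,1,2 for τ_1,τ_2,τ_3)
  τ : Fin 3 → Seed → Seed
  τ zero             t = μ (# 0) (μ (# 1) t)
  τ (suc zero)       t = μ (# 2) (μ (# 3) t)
  τ (suc (suc zero)) t = μ (# 4) (μ (# 5) t)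

  -- seed after the first n terms of S (S 0 = s_1, S 1 = s_2, ...)
  seedAfter : (Fin 6 → Carrier) → (ℕ → Fin 3) → ℕ → Seed
  seedAfter x S zero    = dP3 , x
  seedAfter x S (suc n) = τ (S n) (seedAfter x S n)

  cluster : (Fin 6 → Carrier) → (ℕ → Fin 3) → ℕ → Fin 6 → Carrier
  cluster x S n = proj₂ (seedAfter x S n)

  A B C : (Fin 6 → Carrier) → Carrier
  A x = (x (# 2) * x (# 4) + x (# 3) * x (# 5)) * (x (# 0) * x (# 1)) ⁻¹
  B x = (x (# 1) * x (# 4) + x (# 0) * x (# 5)) * (x (# 2) * x (# 3)) ⁻¹
  C x = (x (# 0) * x (# 2) + x (# 1) * x (# 3)) * (x (# 4) * x (# 5)) ⁻¹

  monomial : (Fin 6 → Carrier) → ℤ × ℤ × ℤ → Carrier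
  monomial x (a , b′ , c′) =
    _^ℤ_ F (A x) a * _^ℤ_ F (B x) b′ * _^ℤ_ F (C x) c′

mutatedBy : Fin 3 → Fin 6 → Bool
mutatedBy zero             i = does (i ≟ # 0) ∨ does (i ≟ # 1)
mutatedBy (suc zero)       i = does (i ≟ # 2) ∨ does (i ≟ # 3)
mutatedBy (suc (suc zero)) i = does (i ≟ # 4) ∨ does (i ≟ # 5)

η : (ℕ → Fin 3) → ℕ → Fin 6 → ℕ
η S zero    i = 0
η S (suc n) i = η S n i ℕ.+ (if mutatedBy (S n) i then 1 else 0)

partner : Fin 6 → Fin 6
partner i with toℕ i
... | 0 = # 1
... | 1 = # 0
... | 2 = # 3
... | 3 = # 2
... | 4 = # 5
... | _ = # 4

f : (ℕ → Fin 3) → ℕ → Fin 6 → Fin 6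
f S n i = if does (η S n i % 2 ℕ.≟ 0) then i else partner i

-- block of vertex k : {0,1} ↦ 0, {2,3} ↦ 1, {4,5} ↦ 2 (index of the
-- exponent triple (a_j,b_j,c_j), j = block + 1)
block : Fin 6 → Fin 3
block i with toℕ i
... | 0 = # 0
... | 1 = # 0
... | 2 = # 1
... | 3 = # 1
... | _ = # 2

module Submission where

open import Defs
open import Level using (Level)
open import Data.Nat using (ℕ)
open import Data.Integer using (ℤ)
open import Data.Fin using (Fin)
open import Data.Product using (Σ; _×_)

open import Data.Nat as ℕ using (zero; suc; _%_)
import Data.Nat.Properties as ℕ
open import Data.Nat.DivMod using ([m+n]%n≡m%n)
open import Data.Integer as ℤ using (+_; -[1+_]; _⊖_; 0ℤ)
import Data.Integer.Properties as ℤ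
open import Data.Fin using (zero; suc; #_; _≟_)
open import Data.Fin.Properties using (all?)
open import Data.Bool using (Bool; true; false; not; if_then_else_)
import Data.Bool.Properties as Bool
open import Data.Product using (_,_; proj₁; proj₂)
open import Data.Sum using (_⊎_; inj₁; inj₂)
open import Data.Vec using ([]; _∷_)
open import Relation.Nullary using (does; yes; no; contradiction)
open import Relation.Nullary.Decidable using (from-yes; _→-dec_; _×-dec_; dec-true; dec-false)
open import Relation.Binary.PropositionalEquality using (_≡_; _≢_; refl; sym; trans; cong; cong₂; module ≡-Reasoning)
open import Function.Definitions using (Injective)
open import Algebra.Bundles using (AbelianGroup; CommutativeMonoid)
open import Algebra.Structures using (IsAbelianGroup; IsCommutativeSemigroup)

-- Call a block "swapped" when its two vertices have each been
-- mutated an odd number of times, and let π_σ be the involution of the vertices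
-- exchanging the two vertices of every swapped block (σ records the swapped
-- blocks).  We show by induction on n the invariant
--   (M) the exchange matrix is dP3 relabelled by π_σ, and
--   (V) the variable at k is x_{π_σ k} times W_{block k},
-- where W_t is the monomial A^a B^b C^c of an exponent vector E_t computed by a
-- purely combinatorial recursion.  The theorem follows because f(n,k) = π_σ(k).
--
-- (M) is preserved because mutation commutes with relabelling, so it suffices to
-- check once, on dP3 itself, that mutating both vertices of a block swaps them.
-- (V) is preserved because in dP3 every vertex v has one out- and one
-- in-neighbour in each of the other two blocks, and the two monomials of its
-- exchange relation add up to the numerator of the Laurent polynomial
-- (A, B or C) of its block, whose denominator is x_v times the variable of the
-- partner of v.

-- The two vertices of a block: lo s = 2s and hi s = 2s+1.  A τ-step at s
-- mutates hi s first and lo s second.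
lo hi : Fin 3 → Fin 6
lo zero             = # 0
lo (suc zero)       = # 2
lo (suc (suc zero)) = # 4
hi zero             = # 1
hi (suc zero)       = # 3
hi (suc (suc zero)) = # 5

block-lo : ∀ s → block (lo s) ≡ s
block-lo zero             = refl
block-lo (suc zero)       = refl
block-lo (suc (suc zero)) = refl

block-hi : ∀ s → block (hi s) ≡ s
block-hi zero             = refl
block-hi (suc zero)       = refl
block-hi (suc (suc zero)) = refl

lo≢hi : ∀ s → lo s ≢ hi s
lo≢hi zero             ()
lo≢hi (suc zero)       ()
lo≢hi (suc (suc zero)) ()

data Position (s : Fin 3) : Fin 6 → Set where
  first  : Position s (lo s)
  second : Position s (hi s)
  other  : ∀ {k} → block k ≢ s → Position s k

position : ∀ s k → Position s k
position s k with block k ≟ s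
... | no k∉s   = other k∉s
... | yes refl = inside k
  where
  inside : ∀ k → Position (block k) k
  inside zero                                = first
  inside (suc zero)                          = second
  inside (suc (suc zero))                    = first
  inside (suc (suc (suc zero)))              = second
  inside (suc (suc (suc (suc zero))))        = first
  inside (suc (suc (suc (suc (suc zero)))))  = second

block-partner : ∀ k → block (partner k) ≡ block k
block-partner = from-yes (all? λ k → block (partner k) ≟ block k)

partner-involutive : ∀ k → partner (partner k) ≡ k
partner-involutive = from-yes (all? λ k → partner (partner k) ≟ k)

-- σ t records whether block t is currently swapped.
Swaps : Set
Swaps = Fin 3 → Bool

flip : Fin 3 → Swaps → Swaps
flip s σ t = if does (s ≟ t) then not (σ t) else σ t

perm : Swaps → Fin 6 → Fin 6
perm σ k = if σ (block k) then partner k else k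

state : (ℕ → Fin 3) → ℕ → Swaps
state S zero    t = false
state S (suc n) = flip (S n) (state S n)

block-perm : ∀ σ k → block (perm σ k) ≡ block k
block-perm σ k with σ (block k)
... | true  = block-partner k
... | false = refl

perm-involutive : ∀ σ k → perm σ (perm σ k) ≡ k
perm-involutive σ k with σ (block k) in swapped
... | false rewrite swapped = refl
... | true  rewrite block-partner k | swapped = partner-involutive k

perm-injective : ∀ σ → Injective _≡_ _≡_ (perm σ)
perm-injective σ {i} {j} πi≡πj =
  trans (sym (perm-involutive σ i)) (trans (cong (perm σ) πi≡πj) (perm-involutive σ j))

perm-flip-inside : ∀ s σ k → block k ≡ s → perm (flip s σ) k ≡ partner (perm σ k)
perm-flip-inside s σ k refl rewrite dec-true (block k ≟ block k) refl with σ (block k)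
... | true  = sym (partner-involutive k)
... | false = refl

perm-flip-outside : ∀ s σ k → block k ≢ s → perm (flip s σ) k ≡ perm σ k
perm-flip-outside s σ k k∉s rewrite dec-false (s ≟ block k) (λ eq → k∉s (sym eq)) = refl

-- The function f of the theorem is π_σ for the current swaps: a block is swapped
-- exactly when its vertices have been mutated an odd number of times.
mutatedBy-block : ∀ s k → mutatedBy s k ≡ does (s ≟ block k)
mutatedBy-block = from-yes (all? λ s → all? λ k → mutatedBy s k Bool.≟ does (s ≟ block k))

isEven : ℕ → Bool
isEven m = does (m % 2 ℕ.≟ 0)

isEven-suc : ∀ m → isEven (suc m) ≡ not (isEven m)
isEven-suc zero          = refl
isEven-suc (suc zero)    = refl
isEven-suc (suc (suc m)) =
  trans (isEven-+2 (suc m)) (trans (isEven-suc m) (cong not (sym (isEven-+2 m))))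
  where
  isEven-+2 : ∀ m → isEven (suc (suc m)) ≡ isEven m
  isEven-+2 m = cong (λ r → does (r ℕ.≟ 0))
                     (trans (cong (_% 2) (ℕ.+-comm 2 m)) ([m+n]%n≡m%n m 2))

η-parity : ∀ S n k → isEven (η S n k) ≡ not (state S n (block k))
η-parity S zero    k = refl
η-parity S (suc n) k rewrite mutatedBy-block (S n) k with S n ≟ block k
... | yes _ = begin
  isEven (η S n k ℕ.+ 1)           ≡⟨ cong isEven (ℕ.+-comm (η S n k) 1) ⟩
  isEven (suc (η S n k))           ≡⟨ isEven-suc (η S n k) ⟩
  not (isEven (η S n k))           ≡⟨ cong not (η-parity S n k) ⟩
  not (not (state S n (block k)))  ∎
  where open ≡-Reasoning
... | no _ = trans (cong isEven (ℕ.+-identityʳ (η S n k))) (η-parity S n k)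

f-perm : ∀ S n k → f S n k ≡ perm (state S n) k
f-perm S n k with η-parity S n k
... | _ with isEven (η S n k) | state S n (block k)
...   | true  | false = refl
...   | false | true  = refl

infix 4 _≐_
_≐_ : ExMatrix → ExMatrix → Set
b ≐ b′ = ∀ i j → b i j ≡ b′ i j

relabel : (Fin 6 → Fin 6) → ExMatrix → ExMatrix
relabel π b i j = b (π i) (π j)

Mat : Swaps → ExMatrix
Mat σ = relabel (perm σ) dP3

does-injective : ∀ {m n} (π : Fin m → Fin n) → Injective _≡_ _≡_ π →
                 ∀ i j → does (π i ≟ π j) ≡ does (i ≟ j)
does-injective π inj i j with i ≟ j | π i ≟ π j
... | yes refl | yes _         = refl
... | yes refl | no πi≢πi      = contradiction refl πi≢πi
... | no i≢j   | yes πi≡πj     = contradiction (inj πi≡πj) i≢j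
... | no _     | no _          = refl

mutB-relabel : (π : Fin 6 → Fin 6) → Injective _≡_ _≡_ π → ∀ k b →
               mutB k (relabel π b) ≐ relabel π (mutB (π k) b)
mutB-relabel π inj k b i j
  rewrite does-injective π inj i k | does-injective π inj j k = refl

mutB-cong : ∀ k {b b′} → b ≐ b′ → mutB k b ≐ mutB k b′
mutB-cong k {b} {b′} b≐b′ i j rewrite b≐b′ i j | b≐b′ i k | b≐b′ k j = refl

mutB-row-unchanged : ∀ k b i → i ≢ k → b i k ≡ 0ℤ → ∀ j → mutB k b i j ≡ b i j
mutB-row-unchanged k b i i≢k bik≡0 j rewrite dec-false (i ≟ k) i≢k with j ≟ k
... | yes refl rewrite bik≡0 = refl
... | no _     rewrite bik≡0 = trans (ℤ.+-identityʳ _) (ℤ.+-identityʳ (b i j))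

swap : Fin 3 → Fin 6 → Fin 6
swap s u = if does (s ≟ block u) then partner u else u

swap-inside : ∀ s u → block u ≡ s → swap s u ≡ partner u
swap-inside s u u∈s rewrite dec-true (s ≟ block u) (sym u∈s) = refl

swap-outside : ∀ s u → block u ≢ s → swap s u ≡ u
swap-outside s u u∉s rewrite dec-false (s ≟ block u) (λ eq → u∉s (sym eq)) = refl

swap-perm : ∀ s σ i → swap s (perm σ i) ≡ perm (flip s σ) i
swap-perm s σ i with block i ≟ s
... | yes i∈s = trans (swap-inside s (perm σ i) (trans (block-perm σ i) i∈s))
                      (sym (perm-flip-inside s σ i i∈s))
... | no i∉s  = trans (swap-outside s (perm σ i) (λ eq → i∉s (trans (sym (block-perm σ i)) eq)))
                      (sym (perm-flip-outside s σ i i∉s))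

dP3-block-free : ∀ u v → block u ≡ block v → dP3 u v ≡ 0ℤ
dP3-block-free = from-yes (all? λ u → all? λ v → (block u ≟ block v) →-dec (dP3 u v ℤ.≟ 0ℤ))

dP3-lo-hi : ∀ s → relabel (swap s) dP3 ≐ mutB (lo s) (mutB (hi s) dP3)
dP3-lo-hi = from-yes (all? λ s → all? λ i → all? λ j →
  relabel (swap s) dP3 i j ℤ.≟ mutB (lo s) (mutB (hi s) dP3) i j)

dP3-hi-lo : ∀ s → relabel (swap s) dP3 ≐ mutB (hi s) (mutB (lo s) dP3)
dP3-hi-lo = from-yes (all? λ s → all? λ i → all? λ j →
  relabel (swap s) dP3 i j ℤ.≟ mutB (hi s) (mutB (lo s) dP3) i j)

perm-block-ends : ∀ σ s → (perm σ (lo s) ≡ lo s × perm σ (hi s) ≡ hi s)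
                        ⊎ (perm σ (lo s) ≡ hi s × perm σ (hi s) ≡ lo s)
perm-block-ends σ zero with σ zero
... | false = inj₁ (refl , refl)
... | true  = inj₂ (refl , refl)
perm-block-ends σ (suc zero) with σ (suc zero)
... | false = inj₁ (refl , refl)
... | true  = inj₂ (refl , refl)
perm-block-ends σ (suc (suc zero)) with σ (suc (suc zero))
... | false = inj₁ (refl , refl)
... | true  = inj₂ (refl , refl)

dP3-block-mutation : ∀ σ s → relabel (swap s) dP3 ≐ mutB (perm σ (lo s)) (mutB (perm σ (hi s)) dP3)
dP3-block-mutation σ s with perm σ (lo s) | perm σ (hi s) | perm-block-ends σ s
... | _ | _ | inj₁ (refl , refl) = dP3-lo-hi s
... | _ | _ | inj₂ (refl , refl) = dP3-hi-lo s

mat-step : ∀ s σ b → b ≐ Mat σ → mutB (lo s) (mutB (hi s) b) ≐ Mat (flip s σ)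
mat-step s σ b b≐Mat i j = begin
  mutB (lo s) (mutB (hi s) b) i j
    ≡⟨ mutB-cong (lo s) (mutB-cong (hi s) b≐Mat) i j ⟩
  mutB (lo s) (mutB (hi s) (relabel π dP3)) i j
    ≡⟨ mutB-cong (lo s) (mutB-relabel π inj (hi s) dP3) i j ⟩
  mutB (lo s) (relabel π (mutB (π (hi s)) dP3)) i j
    ≡⟨ mutB-relabel π inj (lo s) (mutB (π (hi s)) dP3) i j ⟩
  mutB (π (lo s)) (mutB (π (hi s)) dP3) (π i) (π j)
    ≡⟨ dP3-block-mutation σ s (π i) (π j) ⟨
  dP3 (swap s (π i)) (swap s (π j))
    ≡⟨ cong₂ dP3 (swap-perm s σ i) (swap-perm s σ j) ⟩
  Mat (flip s σ) i j ∎
  where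
  open ≡-Reasoning
  π = perm σ
  inj = perm-injective σ

δ : ∀ {m} → Fin m → Fin m → ℕ
δ a i = if does (a ≟ i) then 1 else 0

δ-perm : ∀ σ a i → δ a (perm σ i) ≡ δ (perm σ a) i
δ-perm σ a i = begin
  δ a (perm σ i)
    ≡⟨ cong (λ b → if b then 1 else 0) (does-injective (perm σ) (perm-injective σ) a (perm σ i)) ⟨
  δ (perm σ a) (perm σ (perm σ i))
    ≡⟨ cong (δ (perm σ a)) (perm-involutive σ i) ⟩
  δ (perm σ a) i ∎
  where open ≡-Reasoning

-- The neighbourhood of a vertex of dP3: the heads of its two outgoing arrows and
-- the tails of its two incoming arrows, listed by block (see star-blocks).
record Star : Set where
  field out₁ out₂ in₁ in₂ : Fin 6

star : Fin 6 → Star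
star zero                               = record { out₁ = # 3 ; out₂ = # 5 ; in₁ = # 2 ; in₂ = # 4 }
star (suc zero)                         = record { out₁ = # 2 ; out₂ = # 4 ; in₁ = # 3 ; in₂ = # 5 }
star (suc (suc zero))                   = record { out₁ = # 0 ; out₂ = # 5 ; in₁ = # 1 ; in₂ = # 4 }
star (suc (suc (suc zero)))             = record { out₁ = # 1 ; out₂ = # 4 ; in₁ = # 0 ; in₂ = # 5 }
star (suc (suc (suc (suc zero))))       = record { out₁ = # 0 ; out₂ = # 2 ; in₁ = # 1 ; in₂ = # 3 }
star (suc (suc (suc (suc (suc zero))))) = record { out₁ = # 1 ; out₂ = # 3 ; in₁ = # 0 ; in₂ = # 2 }

out₁ out₂ in₁ in₂ : Fin 6 → Fin 6
out₁ v = Star.out₁ (star v)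
out₂ v = Star.out₂ (star v)
in₁  v = Star.in₁ (star v)
in₂  v = Star.in₂ (star v)

other₁ other₂ : Fin 3 → Fin 3
other₁ zero             = # 1
other₁ (suc zero)       = # 0
other₁ (suc (suc zero)) = # 0
other₂ zero             = # 2
other₂ (suc zero)       = # 2
other₂ (suc (suc zero)) = # 1

other₁≢ : ∀ s → other₁ s ≢ s
other₁≢ zero             ()
other₁≢ (suc zero)       ()
other₁≢ (suc (suc zero)) ()

other₂≢ : ∀ s → other₂ s ≢ s
other₂≢ zero             ()
other₂≢ (suc zero)       ()
other₂≢ (suc (suc zero)) ()

dP3-out : ∀ v u → pos (dP3 v u) ≡ δ (out₁ v) u ℕ.+ δ (out₂ v) u
dP3-out = from-yes (all? λ v → all? λ u → pos (dP3 v u) ℕ.≟ δ (out₁ v) u ℕ.+ δ (out₂ v) u)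

dP3-in : ∀ v u → pos (ℤ.- dP3 v u) ≡ δ (in₁ v) u ℕ.+ δ (in₂ v) u
dP3-in = from-yes (all? λ v → all? λ u → pos (ℤ.- dP3 v u) ℕ.≟ δ (in₁ v) u ℕ.+ δ (in₂ v) u)

star-blocks : ∀ v → block (out₁ v) ≡ other₁ (block v) × block (out₂ v) ≡ other₂ (block v)
                  × block (in₁ v) ≡ other₁ (block v) × block (in₂ v) ≡ other₂ (block v)
star-blocks = from-yes (all? λ v →
  (block (out₁ v) ≟ other₁ (block v)) ×-dec (block (out₂ v) ≟ other₂ (block v))
  ×-dec (block (in₁ v) ≟ other₁ (block v)) ×-dec (block (in₂ v) ≟ other₂ (block v)))

Mat-out : ∀ σ k i → pos (Mat σ k i) ≡ δ (perm σ (out₁ (perm σ k))) i ℕ.+ δ (perm σ (out₂ (perm σ k))) i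
Mat-out σ k i = trans (dP3-out (perm σ k) (perm σ i)) (cong₂ ℕ._+_ (δ-perm σ _ i) (δ-perm σ _ i))

Mat-in : ∀ σ k i → pos (ℤ.- Mat σ k i) ≡ δ (perm σ (in₁ (perm σ k))) i ℕ.+ δ (perm σ (in₂ (perm σ k))) i
Mat-in σ k i = trans (dP3-in (perm σ k) (perm σ i)) (cong₂ ℕ._+_ (δ-perm σ _ i) (δ-perm σ _ i))

-- Exponent vectors (a, b, c) of monomials A^a B^b C^c, and the exponents E_t
-- of the three blocks after n steps: τ_s replaces E_s by
-- e_s + E_{other₁ s} + E_{other₂ s} − E_s, mirroring the exchange relation.
Exponent : Set
Exponent = ℤ × ℤ × ℤ

infixl 6 _+ᵉ_
_+ᵉ_ : Exponent → Exponent → Exponent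
(a , b , c) +ᵉ (a′ , b′ , c′) = (a ℤ.+ a′ , b ℤ.+ b′ , c ℤ.+ c′)

-ᵉ_ : Exponent → Exponent
-ᵉ (a , b , c) = (ℤ.- a , ℤ.- b , ℤ.- c)

0ᵉ : Exponent
0ᵉ = (0ℤ , 0ℤ , 0ℤ)

unitᵉ : Fin 3 → Exponent
unitᵉ zero             = (ℤ.1ℤ , 0ℤ , 0ℤ)
unitᵉ (suc zero)       = (0ℤ , ℤ.1ℤ , 0ℤ)
unitᵉ (suc (suc zero)) = (0ℤ , 0ℤ , ℤ.1ℤ)

mutatedExponent : Fin 3 → (Fin 3 → Exponent) → Exponent
mutatedExponent s E = unitᵉ s +ᵉ E (other₁ s) +ᵉ E (other₂ s) +ᵉ -ᵉ E s

update : Fin 3 → (Fin 3 → Exponent) → Fin 3 → Exponent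
update s E t = if does (s ≟ t) then mutatedExponent s E else E t

update-inside : ∀ s E t → t ≡ s → update s E t ≡ mutatedExponent s E
update-inside s E t refl rewrite dec-true (t ≟ t) refl = refl

update-outside : ∀ s E t → t ≢ s → update s E t ≡ E t
update-outside s E t t≢s rewrite dec-false (s ≟ t) (λ eq → t≢s (sym eq)) = refl

exponents : (ℕ → Fin 3) → ℕ → Fin 3 → Exponent
exponents S zero    t = 0ᵉ
exponents S (suc n) = update (S n) (exponents S n)

module Laws {c ℓ} (F : Semifield c ℓ) where
  open Semifield F
  open IsAbelianGroup *-isAbelianGroup
    using (setoid; assoc; comm; identityˡ; identityʳ; inverseʳ; ⁻¹-cong; ∙-congˡ; ∙-congʳ)
    renaming (refl to ≈-refl; sym to ≈-sym; trans to ≈-trans; reflexive to ≈-reflexive; ∙-cong to *-cong)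
  open IsCommutativeSemigroup +-isCommutativeSemigroup using () renaming (comm to +-comm; ∙-cong to +-cong)
  open import Relation.Binary.Reasoning.Setoid setoid

  *-abelianGroup : AbelianGroup c ℓ
  *-abelianGroup = record { isAbelianGroup = *-isAbelianGroup }

  open import Algebra.Properties.AbelianGroup *-abelianGroup using (⁻¹-∙-comm)
  open import Algebra.Properties.Group (AbelianGroup.group *-abelianGroup) using (ε⁻¹≈ε; ⁻¹-involutive)
  open import Algebra.Properties.CommutativeSemigroup
    (CommutativeMonoid.commutativeSemigroup (AbelianGroup.commutativeMonoid *-abelianGroup))
    using (interchange)
  open import Algebra.Solver.CommutativeMonoid (AbelianGroup.commutativeMonoid *-abelianGroup)
    using (Expr; prove; var; _⊕_)

  infixr 8 _^_ _^ᶻ_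
  _^_ : Carrier → ℕ → Carrier
  _^_ = _^ℕ_ F

  _^ᶻ_ : Carrier → ℤ → Carrier
  _^ᶻ_ = _^ℤ_ F

  ⁻¹-distrib : ∀ a b → (a * b) ⁻¹ ≈ a ⁻¹ * b ⁻¹
  ⁻¹-distrib a b = ≈-sym (⁻¹-∙-comm a b)

  ^-+ : ∀ X m n → X ^ (m ℕ.+ n) ≈ X ^ m * X ^ n
  ^-+ X zero n = ≈-sym (identityˡ _)
  ^-+ X (suc m) n = begin
    X * X ^ (m ℕ.+ n)    ≈⟨ ∙-congˡ (^-+ X m n) ⟩
    X * (X ^ m * X ^ n)  ≈⟨ assoc X _ _ ⟨
    X * X ^ m * X ^ n    ∎

  ^ᶻ-⊖ : ∀ X m n → X ^ᶻ (m ⊖ n) ≈ X ^ m * (X ^ n) ⁻¹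
  ^ᶻ-⊖ X m zero = begin
    X ^ m                ≈⟨ identityʳ _ ⟨
    X ^ m * 1#           ≈⟨ ∙-congˡ ε⁻¹≈ε ⟨
    X ^ m * 1# ⁻¹        ∎
  ^ᶻ-⊖ X zero (suc n) = ≈-sym (identityˡ _)
  ^ᶻ-⊖ X (suc m) (suc n) = begin
    X ^ᶻ (suc m ⊖ suc n)                ≡⟨ cong (X ^ᶻ_) (ℤ.[1+m]⊖[1+n]≡m⊖n m n) ⟩
    X ^ᶻ (m ⊖ n)                        ≈⟨ ^ᶻ-⊖ X m n ⟩
    X ^ m * (X ^ n) ⁻¹                  ≈⟨ identityˡ _ ⟨
    1# * (X ^ m * (X ^ n) ⁻¹)           ≈⟨ ∙-congʳ (inverseʳ X) ⟨
    X * X ⁻¹ * (X ^ m * (X ^ n) ⁻¹)     ≈⟨ interchange X (X ⁻¹) (X ^ m) ((X ^ n) ⁻¹) ⟩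
    X * X ^ m * (X ⁻¹ * (X ^ n) ⁻¹)     ≈⟨ ∙-congˡ (⁻¹-distrib X (X ^ n)) ⟨
    X * X ^ m * (X * X ^ n) ⁻¹          ∎

  ^ᶻ-+ : ∀ X a b → X ^ᶻ (a ℤ.+ b) ≈ X ^ᶻ a * X ^ᶻ b
  ^ᶻ-+ X (+ m) (+ n) = ^-+ X m n
  ^ᶻ-+ X (+ m) -[1+ n ] = ^ᶻ-⊖ X m (suc n)
  ^ᶻ-+ X -[1+ m ] (+ n) = ≈-trans (^ᶻ-⊖ X n (suc m)) (comm _ _)
  ^ᶻ-+ X -[1+ m ] -[1+ n ] = begin
    (X ^ suc (suc (m ℕ.+ n))) ⁻¹         ≡⟨ cong (λ e → (X ^ suc e) ⁻¹) (ℕ.+-suc m n) ⟨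
    (X ^ (suc m ℕ.+ suc n)) ⁻¹           ≈⟨ ⁻¹-cong (^-+ X (suc m) (suc n)) ⟩
    (X ^ suc m * X ^ suc n) ⁻¹           ≈⟨ ⁻¹-distrib _ _ ⟩
    (X ^ suc m) ⁻¹ * (X ^ suc n) ⁻¹      ∎

  ^ᶻ-neg : ∀ X a → X ^ᶻ (ℤ.- a) ≈ (X ^ᶻ a) ⁻¹
  ^ᶻ-neg X (+ zero) = ≈-sym ε⁻¹≈ε
  ^ᶻ-neg X (+ suc n) = ≈-refl
  ^ᶻ-neg X -[1+ n ] = ≈-sym (⁻¹-involutive _)

  ∏-cong : ∀ m {g h : Fin m → Carrier} → (∀ i → g i ≈ h i) → ∏ F m g ≈ ∏ F m h
  ∏-cong zero    g≈h = ≈-refl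
  ∏-cong (suc m) g≈h = *-cong (g≈h zero) (∏-cong m (λ i → g≈h (suc i)))

  ∏-* : ∀ m (g h : Fin m → Carrier) → ∏ F m (λ i → g i * h i) ≈ ∏ F m g * ∏ F m h
  ∏-* zero    g h = ≈-sym (identityˡ 1#)
  ∏-* (suc m) g h = begin
    g zero * h zero * ∏ F m (λ i → g (suc i) * h (suc i))
      ≈⟨ ∙-congˡ (∏-* m (λ i → g (suc i)) (λ i → h (suc i))) ⟩
    g zero * h zero * (∏ F m (λ i → g (suc i)) * ∏ F m (λ i → h (suc i)))
      ≈⟨ interchange _ _ _ _ ⟩
    g zero * ∏ F m (λ i → g (suc i)) * (h zero * ∏ F m (λ i → h (suc i))) ∎

  ∏-1 : ∀ m → ∏ F m (λ _ → 1#) ≈ 1#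
  ∏-1 zero    = ≈-refl
  ∏-1 (suc m) = ≈-trans (identityˡ _) (∏-1 m)

  ∏-δ : ∀ m (y : Fin m → Carrier) a → ∏ F m (λ i → y i ^ δ a i) ≈ y a
  ∏-δ (suc m) y zero = ≈-trans (*-cong (identityʳ (y zero)) (∏-1 m)) (identityʳ (y zero))
  ∏-δ (suc m) y (suc a) = ≈-trans (identityˡ _) (∏-δ m (λ i → y (suc i)) a)

  ∏-pair : ∀ m (y : Fin m → Carrier) a b (e : Fin m → ℕ) → (∀ i → e i ≡ δ a i ℕ.+ δ b i) →
           ∏ F m (λ i → y i ^ e i) ≈ y a * y b
  ∏-pair m y a b e e≡δ+δ = begin
    ∏ F m (λ i → y i ^ e i)                            ≈⟨ ∏-cong m (λ i → ≈-reflexive (cong (y i ^_) (e≡δ+δ i))) ⟩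
    ∏ F m (λ i → y i ^ (δ a i ℕ.+ δ b i))              ≈⟨ ∏-cong m (λ i → ^-+ (y i) (δ a i) (δ b i)) ⟩
    ∏ F m (λ i → y i ^ δ a i * y i ^ δ b i)            ≈⟨ ∏-* m _ _ ⟩
    ∏ F m (λ i → y i ^ δ a i) * ∏ F m (λ i → y i ^ δ b i) ≈⟨ *-cong (∏-δ m y a) (∏-δ m y b) ⟩
    y a * y b                                          ∎

  factor-sum : ∀ a b c d W₁ W₂ → a * W₁ * (b * W₂) + c * W₁ * (d * W₂) ≈ (a * b + c * d) * (W₁ * W₂)
  factor-sum a b c d W₁ W₂ = begin
    a * W₁ * (b * W₂) + c * W₁ * (d * W₂)  ≈⟨ +-cong (interchange a W₁ b W₂) (interchange c W₁ d W₂) ⟩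
    a * b * (W₁ * W₂) + c * d * (W₁ * W₂)  ≈⟨ proj₂ distrib (W₁ * W₂) (a * b) (c * d) ⟨
    (a * b + c * d) * (W₁ * W₂)            ∎

  regroup : ∀ N W₁ W₂ W u u′ → N * (W₁ * W₂) * (u * W) ⁻¹ ≈ u′ * (N * (u * u′) ⁻¹ * W₁ * W₂ * W ⁻¹)
  regroup N W₁ W₂ W u u′ = begin
    N * (W₁ * W₂) * (u * W) ⁻¹                       ≈⟨ ∙-congˡ (⁻¹-distrib u W) ⟩
    N * (W₁ * W₂) * (u ⁻¹ * W ⁻¹)                    ≈⟨ identityˡ _ ⟨
    1# * (N * (W₁ * W₂) * (u ⁻¹ * W ⁻¹))             ≈⟨ ∙-congʳ (inverseʳ u′) ⟨
    u′ * u′ ⁻¹ * (N * (W₁ * W₂) * (u ⁻¹ * W ⁻¹))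
      ≈⟨ prove 7 ((v₀ ⊕ v₁) ⊕ ((v₂ ⊕ (v₃ ⊕ v₄)) ⊕ (v₅ ⊕ v₆)))
                 (v₀ ⊕ ((((v₂ ⊕ (v₅ ⊕ v₁)) ⊕ v₃) ⊕ v₄) ⊕ v₆))
                 (u′ ∷ u′ ⁻¹ ∷ N ∷ W₁ ∷ W₂ ∷ u ⁻¹ ∷ W ⁻¹ ∷ []) ⟩
    u′ * (N * (u ⁻¹ * u′ ⁻¹) * W₁ * W₂ * W ⁻¹)
      ≈⟨ ∙-congˡ (∙-congʳ (∙-congʳ (∙-congʳ (∙-congˡ (⁻¹-distrib u u′))))) ⟨
    u′ * (N * (u * u′) ⁻¹ * W₁ * W₂ * W ⁻¹)          ∎
    where
    v₀ v₁ v₂ v₃ v₄ v₅ v₆ : Expr 7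
    v₀ = var (# 0)
    v₁ = var (# 1)
    v₂ = var (# 2)
    v₃ = var (# 3)
    v₄ = var (# 4)
    v₅ = var (# 5)
    v₆ = var (# 6)

  exchange : ExMatrix → (Fin 6 → Carrier) → Fin 6 → Carrier
  exchange b y k = (∏ F 6 (λ i → y i ^ pos (b k i)) + ∏ F 6 (λ i → y i ^ pos (ℤ.- b k i))) * y k ⁻¹

  μ-at : ∀ k b y → proj₂ (μ F k (b , y)) k ≡ exchange b y k
  μ-at k b y rewrite dec-true (k ≟ k) refl = refl

  μ-away : ∀ k b y j → j ≢ k → proj₂ (μ F k (b , y)) j ≡ y j
  μ-away k b y j j≢k rewrite dec-false (j ≟ k) j≢k = refl

  τ-μ : ∀ s t → τ F s t ≡ μ F (lo s) (μ F (hi s) t)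
  τ-μ zero             t = refl
  τ-μ (suc zero)       t = refl
  τ-μ (suc (suc zero)) t = refl

  module _ (x : Fin 6 → Carrier) where

    laurent : Fin 3 → Carrier
    laurent zero             = A F x
    laurent (suc zero)       = B F x
    laurent (suc (suc zero)) = C F x

    monomial-+ᵉ : ∀ e e′ → monomial F x (e +ᵉ e′) ≈ monomial F x e * monomial F x e′
    monomial-+ᵉ (a , b , c) (a′ , b′ , c′) = begin
      A F x ^ᶻ (a ℤ.+ a′) * B F x ^ᶻ (b ℤ.+ b′) * C F x ^ᶻ (c ℤ.+ c′)
        ≈⟨ *-cong (*-cong (^ᶻ-+ _ a a′) (^ᶻ-+ _ b b′)) (^ᶻ-+ _ c c′) ⟩
      α * α′ * (β * β′) * (γ * γ′)  ≈⟨ ∙-congʳ (interchange α α′ β β′) ⟩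
      α * β * (α′ * β′) * (γ * γ′)  ≈⟨ interchange (α * β) (α′ * β′) γ γ′ ⟩
      α * β * γ * (α′ * β′ * γ′)    ∎
      where
      α α′ β β′ γ γ′ : Carrier
      α = A F x ^ᶻ a
      α′ = A F x ^ᶻ a′
      β = B F x ^ᶻ b
      β′ = B F x ^ᶻ b′
      γ = C F x ^ᶻ c
      γ′ = C F x ^ᶻ c′

    monomial--ᵉ : ∀ e → monomial F x (-ᵉ e) ≈ (monomial F x e) ⁻¹
    monomial--ᵉ (a , b , c) = begin
      A F x ^ᶻ (ℤ.- a) * B F x ^ᶻ (ℤ.- b) * C F x ^ᶻ (ℤ.- c)
        ≈⟨ *-cong (*-cong (^ᶻ-neg _ a) (^ᶻ-neg _ b)) (^ᶻ-neg _ c) ⟩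
      (A F x ^ᶻ a) ⁻¹ * (B F x ^ᶻ b) ⁻¹ * (C F x ^ᶻ c) ⁻¹
        ≈⟨ ∙-congʳ (⁻¹-∙-comm _ _) ⟩
      (A F x ^ᶻ a * B F x ^ᶻ b) ⁻¹ * (C F x ^ᶻ c) ⁻¹
        ≈⟨ ⁻¹-∙-comm _ _ ⟩
      (A F x ^ᶻ a * B F x ^ᶻ b * C F x ^ᶻ c) ⁻¹ ∎

    monomial-0ᵉ : monomial F x 0ᵉ ≈ 1#
    monomial-0ᵉ = ≈-trans (identityʳ _) (identityʳ 1#)

    monomial-unitᵉ : ∀ s → monomial F x (unitᵉ s) ≈ laurent s
    monomial-unitᵉ zero = ≈-trans (identityʳ _) (≈-trans (identityʳ _) (identityʳ _))
    monomial-unitᵉ (suc zero) = ≈-trans (identityʳ _) (≈-trans (identityˡ _) (identityʳ _))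
    monomial-unitᵉ (suc (suc zero)) = ≈-trans (∙-congʳ (identityʳ _)) (≈-trans (identityˡ _) (identityʳ _))

    monomial-mutated : ∀ s E → monomial F x (mutatedExponent s E)
      ≈ laurent s * monomial F x (E (other₁ s)) * monomial F x (E (other₂ s)) * (monomial F x (E s)) ⁻¹
    monomial-mutated s E = begin
      monomial F x (unitᵉ s +ᵉ E (other₁ s) +ᵉ E (other₂ s) +ᵉ -ᵉ E s)
        ≈⟨ monomial-+ᵉ (unitᵉ s +ᵉ E (other₁ s) +ᵉ E (other₂ s)) (-ᵉ E s) ⟩
      monomial F x (unitᵉ s +ᵉ E (other₁ s) +ᵉ E (other₂ s)) * monomial F x (-ᵉ E s)
        ≈⟨ *-cong (monomial-+ᵉ (unitᵉ s +ᵉ E (other₁ s)) (E (other₂ s))) (monomial--ᵉ (E s)) ⟩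
      monomial F x (unitᵉ s +ᵉ E (other₁ s)) * monomial F x (E (other₂ s)) * (monomial F x (E s)) ⁻¹
        ≈⟨ ∙-congʳ (∙-congʳ (≈-trans (monomial-+ᵉ (unitᵉ s) (E (other₁ s))) (∙-congʳ (monomial-unitᵉ s)))) ⟩
      laurent s * monomial F x (E (other₁ s)) * monomial F x (E (other₂ s)) * (monomial F x (E s)) ⁻¹ ∎

    binomial : Fin 6 → Carrier
    binomial v = x (out₁ v) * x (out₂ v) + x (in₁ v) * x (in₂ v)

    laurent-star : ∀ v → laurent (block v) ≈ binomial v * (x v * x (partner v)) ⁻¹
    laurent-star zero = ∙-congʳ (+-comm _ _)
    laurent-star (suc zero) = ∙-congˡ (⁻¹-cong (comm _ _))
    laurent-star (suc (suc zero)) = ∙-congʳ (+-comm _ _)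
    laurent-star (suc (suc (suc zero))) = ∙-congˡ (⁻¹-cong (comm _ _))
    laurent-star (suc (suc (suc (suc zero)))) = ≈-refl
    laurent-star (suc (suc (suc (suc (suc zero))))) = *-cong (+-comm _ _) (⁻¹-cong (comm _ _))

    Represents : Swaps → (Fin 3 → Carrier) → (Fin 6 → Carrier) → Set ℓ
    Represents σ W y = ∀ u → y u ≈ x (perm σ u) * W (block u)

    exchange-step : ∀ σ (W : Fin 3 → Carrier) b (y : Fin 6 → Carrier) k → (∀ j → b k j ≡ Mat σ k j) →
      (∀ u → block u ≢ block k → y u ≈ x (perm σ u) * W (block u)) →
      y k ≈ x (perm σ k) * W (block k) →
      exchange b y k ≈ x (partner (perm σ k))
        * (laurent (block k) * W (other₁ (block k)) * W (other₂ (block k)) * W (block k) ⁻¹)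
    exchange-step σ W b y k row outside at-k = begin
      exchange b y k
        ≈⟨ *-cong (+-cong outgoing incoming) (⁻¹-cong at-k) ⟩
      (x (out₁ v) * W₁ * (x (out₂ v) * W₂) + x (in₁ v) * W₁ * (x (in₂ v) * W₂)) * (x v * W s) ⁻¹
        ≈⟨ ∙-congʳ (factor-sum _ _ _ _ W₁ W₂) ⟩
      binomial v * (W₁ * W₂) * (x v * W s) ⁻¹
        ≈⟨ regroup (binomial v) W₁ W₂ (W s) (x v) (x (partner v)) ⟩
      x (partner v) * (binomial v * (x v * x (partner v)) ⁻¹ * W₁ * W₂ * W s ⁻¹)
        ≈⟨ ∙-congˡ (∙-congʳ (∙-congʳ (∙-congʳ laurent-s))) ⟨
      x (partner v) * (laurent s * W₁ * W₂ * W s ⁻¹) ∎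
      where
      s : Fin 3
      s = block k
      v : Fin 6
      v = perm σ k
      W₁ W₂ : Carrier
      W₁ = W (other₁ s)
      W₂ = W (other₂ s)
      v∈s : block v ≡ s
      v∈s = block-perm σ k
      laurent-s : laurent s ≈ binomial v * (x v * x (partner v)) ⁻¹
      laurent-s = ≈-trans (≈-reflexive (cong laurent (sym v∈s))) (laurent-star v)
      -- the neighbours of v lie in the two other blocks, where y is known
      neighbour : ∀ a t → block a ≡ t → t ≢ s → y (perm σ a) ≈ x a * W t
      neighbour a t a∈t t≢s = begin
        y (perm σ a)                                 ≈⟨ outside (perm σ a) πa∉s ⟩
        x (perm σ (perm σ a)) * W (block (perm σ a)) ≡⟨ cong₂ (λ u r → x u * W r) (perm-involutive σ a) πa∈t ⟩
        x a * W t                                    ∎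
        where
        πa∈t : block (perm σ a) ≡ t
        πa∈t = trans (block-perm σ a) a∈t
        πa∉s : block (perm σ a) ≢ s
        πa∉s eq = t≢s (trans (sym πa∈t) eq)
      blocks : block (out₁ v) ≡ other₁ (block v) × block (out₂ v) ≡ other₂ (block v)
             × block (in₁ v) ≡ other₁ (block v) × block (in₂ v) ≡ other₂ (block v)
      blocks = star-blocks v
      outgoing : ∏ F 6 (λ i → y i ^ pos (b k i)) ≈ x (out₁ v) * W₁ * (x (out₂ v) * W₂)
      outgoing = ≈-trans
        (∏-pair 6 y _ _ _ (λ i → trans (cong pos (row i)) (Mat-out σ k i)))
        (*-cong (neighbour _ _ (trans (proj₁ blocks) (cong other₁ v∈s)) (other₁≢ s))
                (neighbour _ _ (trans (proj₁ (proj₂ blocks)) (cong other₂ v∈s)) (other₂≢ s)))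
      incoming : ∏ F 6 (λ i → y i ^ pos (ℤ.- b k i)) ≈ x (in₁ v) * W₁ * (x (in₂ v) * W₂)
      incoming = ≈-trans
        (∏-pair 6 y _ _ _ (λ i → trans (cong (λ r → pos (ℤ.- r)) (row i)) (Mat-in σ k i)))
        (*-cong (neighbour _ _ (trans (proj₁ (proj₂ (proj₂ blocks))) (cong other₁ v∈s)) (other₁≢ s))
                (neighbour _ _ (trans (proj₂ (proj₂ (proj₂ blocks))) (cong other₂ v∈s)) (other₂≢ s)))

    weights : (Fin 3 → Exponent) → Fin 3 → Carrier
    weights E t = monomial F x (E t)

    exchanged-value : ∀ s σ E k → block k ≡ s →
      x (partner (perm σ k)) * (laurent (block k) * weights E (other₁ (block k))
                                * weights E (other₂ (block k)) * weights E (block k) ⁻¹)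
        ≈ x (perm (flip s σ) k) * weights (update s E) (block k)
    exchanged-value s σ E k k∈s = begin
      x (partner (perm σ k)) * (laurent (block k) * weights E (other₁ (block k))
                                * weights E (other₂ (block k)) * weights E (block k) ⁻¹)
        ≈⟨ ∙-congˡ (monomial-mutated (block k) E) ⟨
      x (partner (perm σ k)) * monomial F x (mutatedExponent (block k) E)
        ≡⟨ cong₂ (λ u e → x u * monomial F x e)
                   (sym (perm-flip-inside s σ k k∈s))
                   (sym (trans (update-inside s E (block k) k∈s) (cong (λ t → mutatedExponent t E) (sym k∈s)))) ⟩
      x (perm (flip s σ) k) * weights (update s E) (block k) ∎

    -- The three cases of a τ_s-step: the vertex hi s is exchanged first, with the
    -- original seed; then lo s is exchanged, with a row and neighbours that μ_{hi s}
    -- left untouched (lo s and hi s are not joined); other vertices are unchanged.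
    step-hi : ∀ s σ E b y → b ≐ Mat σ → Represents σ (weights E) y →
      proj₂ (μ F (lo s) (μ F (hi s) (b , y))) (hi s)
        ≈ x (perm (flip s σ) (hi s)) * weights (update s E) (block (hi s))
    step-hi s σ E b y b≐Mat rep = begin
      proj₂ (μ F (lo s) (mutB (hi s) b , y₁)) (hi s)  ≡⟨ μ-away (lo s) (mutB (hi s) b) y₁ (hi s) (λ eq → lo≢hi s (sym eq)) ⟩
      y₁ (hi s)                                       ≡⟨ μ-at (hi s) b y ⟩
      exchange b y (hi s)                             ≈⟨ exchange-step σ (weights E) b y (hi s) (b≐Mat (hi s)) (λ v _ → rep v) (rep (hi s)) ⟩
      _                                               ≈⟨ exchanged-value s σ E (hi s) (block-hi s) ⟩
      x (perm (flip s σ) (hi s)) * weights (update s E) (block (hi s)) ∎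
      where
      y₁ : Fin 6 → Carrier
      y₁ = proj₂ (μ F (hi s) (b , y))

    step-lo : ∀ s σ E b y → b ≐ Mat σ → Represents σ (weights E) y →
      proj₂ (μ F (lo s) (μ F (hi s) (b , y))) (lo s)
        ≈ x (perm (flip s σ) (lo s)) * weights (update s E) (block (lo s))
    step-lo s σ E b y b≐Mat rep = begin
      proj₂ (μ F (lo s) (b₁ , y₁)) (lo s)  ≡⟨ μ-at (lo s) b₁ y₁ ⟩
      exchange b₁ y₁ (lo s)                ≈⟨ exchange-step σ (weights E) b₁ y₁ (lo s) row₁ outside₁ at-lo ⟩
      _                                    ≈⟨ exchanged-value s σ E (lo s) (block-lo s) ⟩
      x (perm (flip s σ) (lo s)) * weights (update s E) (block (lo s)) ∎
      where
      b₁ : ExMatrix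
      b₁ = mutB (hi s) b
      y₁ : Fin 6 → Carrier
      y₁ = proj₂ (μ F (hi s) (b , y))
      same-block : block (perm σ (lo s)) ≡ block (perm σ (hi s))
      same-block = trans (block-perm σ (lo s))
        (trans (block-lo s) (trans (sym (block-hi s)) (sym (block-perm σ (hi s)))))
      row₁ : ∀ j → b₁ (lo s) j ≡ Mat σ (lo s) j
      row₁ j = trans (mutB-row-unchanged (hi s) b (lo s) (lo≢hi s) lo-hi-free j) (b≐Mat (lo s) j)
        where
        lo-hi-free : b (lo s) (hi s) ≡ 0ℤ
        lo-hi-free = trans (b≐Mat (lo s) (hi s)) (dP3-block-free (perm σ (lo s)) (perm σ (hi s)) same-block)
      outside₁ : ∀ v → block v ≢ block (lo s) → y₁ v ≈ x (perm σ v) * weights E (block v)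
      outside₁ v v∉s = ≈-trans (≈-reflexive (μ-away (hi s) b y v v≢hi)) (rep v)
        where
        v≢hi : v ≢ hi s
        v≢hi refl = v∉s (trans (block-hi s) (sym (block-lo s)))
      at-lo : y₁ (lo s) ≈ x (perm σ (lo s)) * weights E (block (lo s))
      at-lo = ≈-trans (≈-reflexive (μ-away (hi s) b y (lo s) (lo≢hi s))) (rep (lo s))

    step-other : ∀ s σ E b y → b ≐ Mat σ → Represents σ (weights E) y → ∀ u → block u ≢ s →
      proj₂ (μ F (lo s) (μ F (hi s) (b , y))) u ≈ x (perm (flip s σ) u) * weights (update s E) (block u)
    step-other s σ E b y b≐Mat rep u u∉s = begin
      proj₂ (μ F (lo s) (mutB (hi s) b , y₁)) u  ≡⟨ μ-away (lo s) (mutB (hi s) b) y₁ u (away-from lo (block-lo s)) ⟩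
      y₁ u                                       ≡⟨ μ-away (hi s) b y u (away-from hi (block-hi s)) ⟩
      y u                                        ≈⟨ rep u ⟩
      x (perm σ u) * weights E (block u)         ≡⟨ cong₂ (λ v e → x v * monomial F x e)
                                                     (sym (perm-flip-outside s σ u u∉s))
                                                     (sym (update-outside s E (block u) u∉s)) ⟩
      x (perm (flip s σ) u) * weights (update s E) (block u) ∎
      where
      y₁ : Fin 6 → Carrier
      y₁ = proj₂ (μ F (hi s) (b , y))
      away-from : ∀ (end : Fin 3 → Fin 6) → block (end s) ≡ s → u ≢ end s
      away-from end end∈s u≡end = u∉s (trans (cong block u≡end) end∈s)

    mutate-block : ∀ s σ E b y → b ≐ Mat σ → Represents σ (weights E) y →
      Represents (flip s σ) (weights (update s E)) (proj₂ (μ F (lo s) (μ F (hi s) (b , y))))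
    mutate-block s σ E b y b≐Mat rep u with position s u
    ... | first     = step-lo s σ E b y b≐Mat rep
    ... | second    = step-hi s σ E b y b≐Mat rep
    ... | other u∉s = step-other s σ E b y b≐Mat rep u u∉s

    seed-invariant : ∀ S n → proj₁ (seedAfter F x S n) ≐ Mat (state S n)
                           × Represents (state S n) (weights (exponents S n)) (proj₂ (seedAfter F x S n))
    seed-invariant S zero = (λ i j → refl) , λ u → ≈-sym (≈-trans (∙-congˡ monomial-0ᵉ) (identityʳ (x u)))
    seed-invariant S (suc n) with seedAfter F x S n | seed-invariant S n
    ... | (b , y) | (b≐Mat , rep) rewrite τ-μ (S n) (b , y) =
      mat-step (S n) (state S n) b b≐Mat , mutate-block (S n) (state S n) (exponents S n) b y b≐Mat rep

    cluster-formula : ∀ S n k → cluster F x S n k ≈ x (f S n k) * monomial F x (exponents S n (block k))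
    cluster-formula S n k = ≈-trans (proj₂ (seed-invariant S n) k)
      (≈-reflexive (cong (λ v → x v * monomial F x (exponents S n (block k))) (sym (f-perm S n k))))

proposition2p4 : ∀ {c ℓ : Level} (S : ℕ → Fin 3) (n : ℕ) →
  Σ (Fin 3 → ℤ × ℤ × ℤ) λ e →
    (F : Semifield c ℓ) (x : Fin 6 → Semifield.Carrier F) (k : Fin 6) →
      Semifield._≈_ F (cluster F x S n k)
        (Semifield._*_ F (x (f S n k)) (monomial F x (e (block k))))
proposition2p4 S n = exponents S n , λ F x k → Laws.cluster-formula F x S n k
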